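{- Let $n\geq 8$ and $a_0,a_1,a_2,a_3\in\mathbb{Z}$ with $a_{i+1}-a_i\geq 2$ for $i=0,1,2$ and $a_3-a_0\leq n-2$. The complex $\langle [\![a_3,a_2-1]\!],[\![a_2,a_1-1]\!],[\![a_1,a_0-1]\!],[\![a_0,a_3-1]\!]\rangle$ on $I_n$ can be obtained from $K_8=\langle[\![0,5]\!],[\![2,7]\!],[\![4,1]\!],[\![6,3]\!]\rangle$ on $I_8$ by finitely many vertex insertions and circular permutations.
   Context: Positions $I_n=\{0,\ldots,n-1\}$ are identified with $\mathbb{Z}/n\mathbb{Z}$; for $a,b\in\mathbb{Z}$, $[\![a,b]\!]=\{c\bmod n: a\leq c\leq b'\}$ with $b'\equiv b\pmod n$, $a\leq b'<a+n$ ($n$ being the number of vertices of the ambient complex). $\langle S_0,\ldots,S_k\rangle$ is the simplicial complex whose maximal simplices are the $S_i$. A circular permutation maps a complex $K$ on $I_m$ to $\{S+c\bmod m: S\in K\}$ for some $c$. Vertex insertion: for $i\in\{0,\ldots,m\}$, $\rho^+_i:\{0,\ldots,m-1\}\to\{0,\ldots,m\}$, $\rho^+_i(j)=j$ if $j<i$ and $j+1$ if $j\geq i$; for a complex $K$ on $I_m$, $\mathrm{ins}_i(K)$ is the complex on $I_{m+1}$ whose simplices are the subsets of the sets $\rho^+_i(S)\cup\{i\}$ (if $S$ contains $(i-1)\bmod m$ or $i\bmod m$) or $\rho^+_i(S)$ (otherwise), for $S\in K$. -}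

module Defs where

open import Data.Nat using (ℕ; zero; suc; _+_; _∸_; _<_)
open import Data.Nat.DivMod using (_%_; _mod_)
open import Data.Nat.Properties using (_≟_)
open import Data.Integer as ℤ using (ℤ; +_)
open import Data.Integer.DivMod using (_%ℕ_)
open import Data.Fin as Fin using (Fin; toℕ; punchIn)
import Data.Fin.Properties as FinP
open import Data.Fin.Subset using (Subset; _⊆_; _∪_; ⁅_⁆)
open import Data.Bool using (Bool; true; false; _∧_; _∨_; if_then_else_)
open import Data.List using (List; []; _∷_; upTo; allFin)
open import Data.Bool.ListAction using (any)
open import Data.List.Relation.Unary.Any using (Any)
open import Data.Vec using (tabulate; lookup)
open import Data.Product using (Σ; _×_; ∃-syntax)
open import Relation.Nullary.Decidable using (⌊_⌋)
open import Relation.Binary.PropositionalEquality using (_≡_)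

-- A simplex on I_m is a subset of Fin m.
-- A simplicial complex on I_m is given by its (downward closed) family of
-- simplices, as a predicate on subsets.
Complex : ℕ → Set₁
Complex m = Subset m → Set

_≅_ : ∀ {m} → Complex m → Complex m → Set
K ≅ L = ∀ T → (K T → L T) × (L T → K T)

⟨_⟩ : ∀ {m} → List (Subset m) → Complex m
⟨ gs ⟩ T = Any (T ⊆_) gs

image : ∀ {m k} → (Fin m → Fin k) → Subset m → Subset k
image {m} f S = tabulate λ y → any (λ x → lookup S x ∧ ⌊ f x FinP.≟ y ⌋) (allFin m)

-- c mod n for c an integer, as an element of I_n (n = 0 gives the empty set)
_modI_ : ℤ → (n : ℕ) → Fin n → Bool
(c modI zero) ()
(c modI suc k) x = ⌊ (c %ℕ suc k) ≟ toℕ x ⌋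

-- [[a , b]] on I_n : { c mod n : a ≤ c ≤ b' } where b' = a + ((b - a) mod n)
-- is the unique b' ≡ b (mod n) with a ≤ b' < a + n.
-- Written as { (a + t) mod n : 0 ≤ t ≤ (b - a) mod n }.
⟦_,_⟧ : ∀ {n} → ℤ → ℤ → Subset n
⟦_,_⟧ {zero} a b = tabulate λ ()
⟦_,_⟧ {n@(suc k)} a b =
  tabulate λ x → any (λ t → ((a ℤ.+ + t) modI n) x) (upTo (suc ((b ℤ.- a) %ℕ n)))

shiftFin : ∀ {m} → ℕ → Fin m → Fin m
shiftFin {suc k} c x = (toℕ x + c) mod suc k

rot : ∀ {m} → ℕ → Complex m → Complex m
rot c K T = ∃[ S ] (K S × T ≡ image (shiftFin c) S)

-- ℕ-valued j mod m (m = 0 is irrelevant since I_0 is empty)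
modN : ℕ → ℕ → ℕ
modN zero j = j
modN (suc k) j = j % suc k

-- does S contain (i-1) mod m or i mod m ?
adjacent : ∀ {m} → Fin (suc m) → Subset m → Bool
adjacent {m} i S =
  any (λ j → lookup S j ∧ (⌊ toℕ j ≟ modN m (toℕ i + (m ∸ 1)) ⌋ ∨ ⌊ toℕ j ≟ modN m (toℕ i) ⌋))
      (allFin m)

-- the image of a simplex S under vertex insertion at i (ρ⁺ᵢ = punchIn i)
insSimplex : ∀ {m} → Fin (suc m) → Subset m → Subset (suc m)
insSimplex i S =
  if adjacent i S then image (punchIn i) S ∪ ⁅ i ⁆ else image (punchIn i) S

ins : ∀ {m} → Fin (suc m) → Complex m → Complex (suc m)
ins i K T = ∃[ S ] (K S × T ⊆ insSimplex i S)

data Reach {m : ℕ} (K : Complex m) : (n : ℕ) → Complex n → Set₁ where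
  done  : Reach K m K
  byRot : ∀ {n L} → Reach K n L → (c : ℕ) → Reach K n (rot c L)
  byIns : ∀ {n L} → Reach K n L → (i : Fin (suc n)) → Reach K (suc n) (ins i L)

Obtainable : ∀ {m n} → Complex m → Complex n → Set₁
Obtainable {m} {n} K L = Σ (Complex n) λ L' → Reach K n L' × (L' ≅ L)

K₈ : Complex 8
K₈ = ⟨ ⟦ + 0 , + 5 ⟧ ∷ ⟦ + 2 , + 7 ⟧ ∷ ⟦ + 4 , + 1 ⟧ ∷ ⟦ + 6 , + 3 ⟧ ∷ [] ⟩

-- Put pⱼ = aⱼ - a₀. The four facets are the cyclic intervals of I_n complementary to the gaps
-- [0, p₁), [p₁, p₂), [p₂, p₃), [p₃, n), each of length at least 2, all shifted by a₀; K₈ is the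
-- case n = 8, (p₁, p₂, p₃) = (2, 4, 6). Inserting a vertex strictly inside a gap lengthens that
-- gap by one and only relabels the vertices of the other gaps, so insertions grow the gaps of K₈
-- to any prescribed lengths ≥ 2, and a circular permutation by a₀ mod n finally puts them in place.

module Submission where

open import Defs
open import Data.Bool using (Bool; true; false; T; _∧_; _∨_)
open import Data.Bool.ListAction using (any)
open import Data.Bool.Properties using (T-≡; T-∧; T-∨)
open import Data.Empty using (⊥; ⊥-elim)
open import Data.Fin as Fin using (Fin; toℕ; fromℕ<; punchIn)
import Data.Fin.Properties as Fin
open import Data.Fin.Subset using (Subset; _∈_; _∉_; _⊆_; _∪_; ⁅_⁆)
open import Data.Fin.Subset.Properties using (⊆-antisym; ⊆-trans; x∈p∪q⁺; x∈p∪q⁻; x∈⁅x⁆; x∈⁅y⁆⇒x≡y)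
open import Data.Integer as ℤ using (ℤ; +_; +[1+_]; -[1+_]; _+_; _*_; _-_; -_) renaming (_≤_ to _≤ℤ_)
open import Data.Integer.DivMod using (_%ℕ_; _/ℕ_; n%ℕd<d; a≡a%ℕn+[a/ℕn]*n)
open import Data.Integer.Properties as ℤ using (+-injective; pos-+; pos-*; +-assoc; +-identityʳ)
open import Data.Integer.Tactic.RingSolver using (solve-∀)
open import Data.List using (List; []; _∷_; map; reverse; allFin; upTo)
open import Data.List.Membership.Propositional using (find; lose)
open import Data.List.Membership.Propositional.Properties using (∈-allFin; ∈-upTo⁺; ∈-upTo⁻)
open import Data.List.Relation.Unary.Any as Any using (Any)
open import Data.List.Relation.Unary.Any.Properties using (any⁺; any⁻; map⁺; map⁻; reverse⁺; reverse⁻)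
open import Data.Nat as ℕ using (ℕ; zero; suc; z≤n; s≤s; s≤s⁻¹; _≤_; _<_; _<?_; _≤?_; NonZero)
open import Data.Nat.DivMod using (_%_; _/_; m≡m%n+[m/n]*n; [m+n]%n≡m%n; m<n⇒m%n≡m)
open import Data.Nat.Properties as ℕ using (≤-refl; ≤-trans; <-trans; n<1+n)
import Data.Nat.Tactic.RingSolver as ℕ-Solver
open import Data.Product using (_×_; _,_; proj₁; proj₂; ∃-syntax)
open import Data.Sum as Sum using (_⊎_; inj₁; inj₂)
open import Data.Sum.Function.Propositional using (_⊎-⇔_)
open import Data.Vec using (tabulate; lookup)
open import Data.Vec.Properties using (lookup∘tabulate; lookup⇒[]=; []=⇒lookup)
open import Function using (_∘_; _⇔_; mk⇔; Equivalence)
open import Function.Construct.Composition using (_⇔-∘_)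
open import Function.Construct.Identity using (⇔-id)
open import Function.Construct.Symmetry using (⇔-sym)
open import Level using (0ℓ)
open import Relation.Binary using (Setoid)
import Relation.Binary.Reasoning.Setoid
open import Relation.Binary.PropositionalEquality
open import Relation.Nullary using (yes; no; ¬_)
open import Relation.Nullary.Decidable using (⌊_⌋; toWitness; fromWitness; _⊎-dec_)

open Equivalence using (to; from)

private
  variable
    m n : ℕ

-- Subsets, images and simplex insertion

∈⇒T-lookup : ∀ {S : Subset n} {x} → x ∈ S → T (lookup S x)
∈⇒T-lookup x∈S = from T-≡ ([]=⇒lookup x∈S)

T-lookup⇒∈ : ∀ {S : Subset n} {x} → T (lookup S x) → x ∈ S
T-lookup⇒∈ {S = S} {x} t = lookup⇒[]= x S (to T-≡ t)

∈-tabulate : ∀ {f : Fin n → Bool} {x} → x ∈ tabulate f ⇔ T (f x)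
∈-tabulate {f = f} {x} = mk⇔
  (subst T (lookup∘tabulate f x) ∘ ∈⇒T-lookup)
  (T-lookup⇒∈ ∘ subst T (sym (lookup∘tabulate f x)))

∈-image⁺ : ∀ {k} (f : Fin m → Fin k) {S x} → x ∈ S → f x ∈ image f S
∈-image⁺ f {S} {x} x∈S = from ∈-tabulate
  (any⁺ _ (lose (∈-allFin x) (from T-∧ (∈⇒T-lookup x∈S , fromWitness refl))))

∈-image⁻ : ∀ {k} (f : Fin m → Fin k) {S y} → y ∈ image f S → ∃[ x ] (x ∈ S × f x ≡ y)
∈-image⁻ {m} f {S} y∈ with find (any⁻ _ (allFin m) (to ∈-tabulate y∈))
... | x , _ , t with to T-∧ t
...   | Sx , fx≡y = x , T-lookup⇒∈ Sx , toWitness fx≡y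

image-mono : ∀ {k} (f : Fin m → Fin k) {S G} → S ⊆ G → image f S ⊆ image f G
image-mono f S⊆G y∈ with ∈-image⁻ f y∈
... | x , x∈S , refl = ∈-image⁺ f (S⊆G x∈S)

image-surjective : ∀ {k} (f : Fin m → Fin k) (g : Fin k → Fin m) → (∀ y → f (g y) ≡ y) →
  ∀ {S R} → (∀ x → f x ∈ R ⇔ x ∈ S) → image f S ≡ R
image-surjective f g fg {S} {R} f∈R⇔∈S = ⊆-antisym ⊆R R⊆
  where
  ⊆R : image f S ⊆ R
  ⊆R y∈ with ∈-image⁻ f y∈
  ... | x , x∈S , refl = from (f∈R⇔∈S x) x∈S
  R⊆ : R ⊆ image f S
  R⊆ {y} y∈R = subst (_∈ image f S) (fg y)
    (∈-image⁺ f (to (f∈R⇔∈S (g y)) (subst (_∈ R) (sym (fg y)) y∈R)))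

⊆-via-punchIn : (i : Fin (suc n)) {S R : Subset (suc n)} →
  (i ∈ S → i ∈ R) → (∀ x → punchIn i x ∈ S → punchIn i x ∈ R) → S ⊆ R
⊆-via-punchIn i {S} {R} at-i at-punchIn {y} y∈S with i Fin.≟ y
... | yes refl = at-i y∈S
... | no i≢y = subst (_∈ R) (Fin.punchIn-punchOut i≢y)
  (at-punchIn _ (subst (_∈ S) (sym (Fin.punchIn-punchOut i≢y)) y∈S))

i∉image-punchIn : (i : Fin (suc n)) {S : Subset n} → i ∉ image (punchIn i) S
i∉image-punchIn i {S} i∈ with ∈-image⁻ (punchIn i) {S} i∈
... | x , _ , eq = Fin.punchInᵢ≢i i x eq

punchIn∈image-punchIn : (i : Fin (suc n)) {S : Subset n} →
  ∀ {x} → punchIn i x ∈ image (punchIn i) S ⇔ x ∈ S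
punchIn∈image-punchIn i {S} {x} = mk⇔ to′ (∈-image⁺ (punchIn i))
  where
  to′ : punchIn i x ∈ image (punchIn i) S → x ∈ S
  to′ ∈img with ∈-image⁻ (punchIn i) ∈img
  ... | x′ , x′∈S , eq = subst (_∈ S) (Fin.punchIn-injective i x′ x eq) x′∈S

i∈insSimplex : (i : Fin (suc n)) (S : Subset n) → i ∈ insSimplex i S ⇔ T (adjacent i S)
i∈insSimplex i S with adjacent i S
... | true  = mk⇔ (λ _ → _) (λ _ → x∈p∪q⁺ (inj₂ (x∈⁅x⁆ i)))
... | false = mk⇔ (i∉image-punchIn i {S}) λ ()

punchIn∈insSimplex : (i : Fin (suc n)) (S : Subset n) → ∀ {x} → punchIn i x ∈ insSimplex i S ⇔ x ∈ S
punchIn∈insSimplex i S {x} with adjacent i S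
... | false = punchIn∈image-punchIn i
... | true  = mk⇔ to′ (x∈p∪q⁺ ∘ inj₁ ∘ from (punchIn∈image-punchIn i))
  where
  to′ : punchIn i x ∈ image (punchIn i) S ∪ ⁅ i ⁆ → x ∈ S
  to′ ∈∪ with x∈p∪q⁻ (image (punchIn i) S) ⁅ i ⁆ ∈∪
  ... | inj₁ ∈img = to (punchIn∈image-punchIn i) ∈img
  ... | inj₂ ∈⁅i⁆ = ⊥-elim (Fin.punchInᵢ≢i i x (x∈⁅y⁆⇒x≡y i ∈⁅i⁆))

insSimplex-unique : (i : Fin (suc n)) (S : Subset n) {R : Subset (suc n)} →
  (i ∈ R ⇔ T (adjacent i S)) → (∀ x → punchIn i x ∈ R ⇔ x ∈ S) → insSimplex i S ≡ R
insSimplex-unique i S at-i at-punchIn = ⊆-antisym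
  (⊆-via-punchIn i (from at-i ∘ to (i∈insSimplex i S))
                   (λ x → from (at-punchIn x) ∘ to (punchIn∈insSimplex i S)))
  (⊆-via-punchIn i (from (i∈insSimplex i S) ∘ to at-i)
                   (λ x → from (punchIn∈insSimplex i S) ∘ to (at-punchIn x)))

Near : Fin (suc n) → Fin n → Set
Near {n} i j = toℕ j ≡ modN n (toℕ i ℕ.+ (n ℕ.∸ 1)) ⊎ toℕ j ≡ modN n (toℕ i)

adjacent⇔ : (i : Fin (suc n)) (S : Subset n) → T (adjacent i S) ⇔ (∃[ j ] (j ∈ S × Near i j))
adjacent⇔ {n} i S = mk⇔ to′ from′
  where
  before = modN n (toℕ i ℕ.+ (n ℕ.∸ 1))
  at = modN n (toℕ i)
  near? : Fin n → Bool
  near? j = ⌊ toℕ j ℕ.≟ before ⌋ ∨ ⌊ toℕ j ℕ.≟ at ⌋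
  to′ : T (adjacent i S) → ∃[ j ] (j ∈ S × Near i j)
  to′ t with find (any⁻ (λ j → lookup S j ∧ near? j) (allFin n) t)
  ... | j , _ , tj with to T-∧ tj
  ...   | Sj , nj = j , T-lookup⇒∈ Sj ,
    Sum.map toWitness toWitness (to (T-∨ {⌊ toℕ j ℕ.≟ before ⌋}) nj)
  from′ : ∃[ j ] (j ∈ S × Near i j) → T (adjacent i S)
  from′ (j , j∈S , nj) = any⁺ (λ j → lookup S j ∧ near? j) (lose (∈-allFin j) (from T-∧ (∈⇒T-lookup j∈S ,
    from (T-∨ {⌊ toℕ j ℕ.≟ before ⌋}) (Sum.map fromWitness fromWitness nj))))

insSimplex-mono : (i : Fin (suc n)) {S G : Subset n} → S ⊆ G → insSimplex i S ⊆ insSimplex i G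
insSimplex-mono i {S} {G} S⊆G = ⊆-via-punchIn i
  (from (i∈insSimplex i G) ∘ adjacent-mono ∘ to (i∈insSimplex i S))
  (λ x → from (punchIn∈insSimplex i G) ∘ S⊆G ∘ to (punchIn∈insSimplex i S))
  where
  adjacent-mono : T (adjacent i S) → T (adjacent i G)
  adjacent-mono t with to (adjacent⇔ i S) t
  ... | j , j∈S , nj = from (adjacent⇔ i G) (j , S⊆G j∈S , nj)

-- Congruences modulo n

-- A record rather than a Σ-type, so that a and b can be inferred from a proof.
infix 4 _≡_[mod_]
infixr 4 _,_
record _≡_[mod_] (a b : ℤ) (n : ℕ) : Set where
  constructor _,_
  field
    quotient : ℤ
    equation : a ≡ b + quotient * + n

module _ {n : ℕ} where

  ≡⇒≡mod : ∀ {a b} → a ≡ b → a ≡ b [mod n ]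
  ≡⇒≡mod {a} refl = + 0 , lemma a (+ n)
    where
    lemma : ∀ a n → a ≡ a + + 0 * n
    lemma = solve-∀

  ≡mod-refl : ∀ {a} → a ≡ a [mod n ]
  ≡mod-refl = ≡⇒≡mod refl

  ≡mod-sym : ∀ {a b} → a ≡ b [mod n ] → b ≡ a [mod n ]
  ≡mod-sym {a} {b} (q , a≡) = - q , (begin
    b                            ≡⟨ lemma b q (+ n) ⟩
    b + q * + n + (- q) * + n    ≡⟨ cong (_+ (- q) * + n) a≡ ⟨
    a + (- q) * + n              ∎)
    where
    open ≡-Reasoning
    lemma : ∀ b q n → b ≡ b + q * n + (- q) * n
    lemma = solve-∀

  ≡mod-trans : ∀ {a b c} → a ≡ b [mod n ] → b ≡ c [mod n ] → a ≡ c [mod n ]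
  ≡mod-trans {c = c} (q , refl) (q′ , refl) = q′ + q , lemma c q q′ (+ n)
    where
    lemma : ∀ c q q′ n → c + q′ * n + q * n ≡ c + (q′ + q) * n
    lemma = solve-∀

  ≡mod-+ : ∀ {a b c d} → a ≡ b [mod n ] → c ≡ d [mod n ] → a + c ≡ b + d [mod n ]
  ≡mod-+ {b = b} {d = d} (q , refl) (q′ , refl) = q + q′ , lemma b d q q′ (+ n)
    where
    lemma : ∀ b d q q′ n → b + q * n + (d + q′ * n) ≡ b + d + (q + q′) * n
    lemma = solve-∀

  ≡mod-- : ∀ {a b c d} → a ≡ b [mod n ] → c ≡ d [mod n ] → a - c ≡ b - d [mod n ]
  ≡mod-- {b = b} {d = d} (q , refl) (q′ , refl) = q - q′ , lemma b d q q′ (+ n)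
    where
    lemma : ∀ b d q q′ n → b + q * n - (d + q′ * n) ≡ b - d + (q - q′) * n
    lemma = solve-∀

  ≡mod-setoid : Setoid 0ℓ 0ℓ
  ≡mod-setoid = record
    { Carrier = ℤ
    ; _≈_ = _≡_[mod n ]
    ; isEquivalence = record { refl = ≡mod-refl ; sym = ≡mod-sym ; trans = ≡mod-trans }
    }

  module ≡mod-Reasoning = Relation.Binary.Reasoning.Setoid ≡mod-setoid

  positive-multiple-too-big : ∀ {r r′ j} → r < n → + r ≡ + r′ + +[1+ j ] * + n → ⊥
  positive-multiple-too-big {r} {r′} {j} r<n eq = ℕ.<⇒≱ r<n (begin
    n                    ≤⟨ ℕ.m≤m+n n (j ℕ.* n) ⟩
    suc j ℕ.* n          ≤⟨ ℕ.m≤n+m (suc j ℕ.* n) r′ ⟩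
    r′ ℕ.+ suc j ℕ.* n   ≡⟨ +-injective r≡ ⟨
    r                    ∎)
    where
    open ℕ.≤-Reasoning
    r≡ : + r ≡ + (r′ ℕ.+ suc j ℕ.* n)
    r≡ = trans eq (trans (cong (λ x → + r′ + x) (sym (pos-* (suc j) n))) (sym (pos-+ r′ _)))

  ≡mod-unique : ∀ {r r′} → r < n → r′ < n → + r ≡ + r′ [mod n ] → r ≡ r′
  ≡mod-unique {r} {r′} r<n r′<n (+ zero , eq) = +-injective (trans eq (lemma (+ r′) (+ n)))
    where
    lemma : ∀ r n → r + + 0 * n ≡ r
    lemma = solve-∀
  ≡mod-unique {r} {r′} r<n r′<n (+[1+ j ] , eq) = ⊥-elim (positive-multiple-too-big {r} {r′} {j} r<n eq)
  ≡mod-unique {r} {r′} r<n r′<n (-[1+ j ] , eq) =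
    ⊥-elim (positive-multiple-too-big {r′} {r} {j} r′<n (_≡_[mod_].equation (≡mod-sym (-[1+ j ] , eq))))


module _ {n : ℕ} .{{_ : NonZero n}} where

  ≡mod-%ℕ : ∀ a → a ≡ + (a %ℕ n) [mod n ]
  ≡mod-%ℕ a = a /ℕ n , a≡a%ℕn+[a/ℕn]*n a n

  %ℕ-≡ : ∀ {a r} → r < n → a ≡ + r [mod n ] → a %ℕ n ≡ r
  %ℕ-≡ {a} r<n a≡r = ≡mod-unique (n%ℕd<d a n) r<n (≡mod-trans (≡mod-sym (≡mod-%ℕ a)) a≡r)

  %-≡mod : ∀ m → + (m % n) ≡ + m [mod n ]
  %-≡mod m = ≡mod-sym (+ (m / n) , (begin
    + m                         ≡⟨ cong +_ (m≡m%n+[m/n]*n m n) ⟩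
    + (m % n ℕ.+ m / n ℕ.* n)   ≡⟨ pos-+ (m % n) _ ⟩
    + (m % n) + + (m / n ℕ.* n) ≡⟨ cong (λ x → + (m % n) + x) (pos-* (m / n) n) ⟩
    + (m % n) + + (m / n) * + n ∎))
    where open ≡-Reasoning

shiftFin-≡mod : ∀ {k} c (x : Fin (suc k)) → + toℕ (shiftFin c x) ≡ + toℕ x + + c [mod suc k ]
shiftFin-≡mod {k} c x = begin
  + toℕ (shiftFin c x)        ≡⟨ cong +_ (Fin.toℕ-fromℕ< _) ⟩
  + ((toℕ x ℕ.+ c) % suc k)   ≈⟨ %-≡mod (toℕ x ℕ.+ c) ⟩
  + (toℕ x ℕ.+ c)             ≡⟨ pos-+ (toℕ x) c ⟩
  + toℕ x + + c               ∎
  where open ≡mod-Reasoning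

shiftFin-cancel : ∀ {k} a b q (x : Fin (suc k)) → b ℕ.+ a ≡ q ℕ.* suc k → shiftFin a (shiftFin b x) ≡ x
shiftFin-cancel {k} a b q x b+a≡ = Fin.toℕ-injective (≡mod-unique (Fin.toℕ<n _) (Fin.toℕ<n x) (begin
  + toℕ (shiftFin a (shiftFin b x))   ≈⟨ shiftFin-≡mod a _ ⟩
  + toℕ (shiftFin b x) + + a          ≈⟨ ≡mod-+ {c = + a} (shiftFin-≡mod b x) (≡⇒≡mod refl) ⟩
  + toℕ x + + b + + a                 ≡⟨ +-assoc (+ toℕ x) (+ b) (+ a) ⟩
  + toℕ x + + (b ℕ.+ a)               ≡⟨ cong (λ m → + toℕ x + + m) b+a≡ ⟩
  + toℕ x + + (q ℕ.* suc k)           ≡⟨ cong (λ m → + toℕ x + m) (pos-* q (suc k)) ⟩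
  + toℕ x + + q * + suc k             ≈⟨ + q , refl ⟩
  + toℕ x                             ∎))
  where open ≡mod-Reasoning

shiftFin-section : ∀ {k} c (y : Fin (suc k)) → shiftFin c (shiftFin (c ℕ.* k) y) ≡ y
shiftFin-section {k} c y =
  shiftFin-cancel c (c ℕ.* k) c y (trans (ℕ.+-comm (c ℕ.* k) c) (sym (ℕ.*-suc c k)))

shiftFin-retraction : ∀ {k} c (x : Fin (suc k)) → shiftFin (c ℕ.* k) (shiftFin c x) ≡ x
shiftFin-retraction {k} c x = shiftFin-cancel (c ℕ.* k) c c x (sym (ℕ.*-suc c k))

-- Obtainable complexes

≅-trans : {K L M : Complex n} → K ≅ L → L ≅ M → K ≅ M
≅-trans K≅L L≅M T = proj₁ (L≅M T) ∘ proj₁ (K≅L T) , proj₂ (K≅L T) ∘ proj₂ (L≅M T)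

ins-cong : (i : Fin (suc n)) {K L : Complex n} → K ≅ L → ins i K ≅ ins i L
ins-cong i K≅L T =
  (λ (S , KS , T⊆) → S , proj₁ (K≅L S) KS , T⊆) , (λ (S , LS , T⊆) → S , proj₂ (K≅L S) LS , T⊆)

rot-cong : ∀ c {K L : Complex n} → K ≅ L → rot c K ≅ rot c L
rot-cong c K≅L T =
  (λ (S , KS , T≡) → S , proj₁ (K≅L S) KS , T≡) , (λ (S , LS , T≡) → S , proj₂ (K≅L S) LS , T≡)

⟨⟩-reverse : (gs : List (Subset n)) → ⟨ gs ⟩ ≅ ⟨ reverse gs ⟩
⟨⟩-reverse gs T = reverse⁺ , reverse⁻

ins-⟨⟩ : (i : Fin (suc n)) (gs : List (Subset n)) → ins i ⟨ gs ⟩ ≅ ⟨ map (insSimplex i) gs ⟩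
ins-⟨⟩ i gs T = to′ , from′
  where
  to′ : ins i ⟨ gs ⟩ T → ⟨ map (insSimplex i) gs ⟩ T
  to′ (S , S⊆∈gs , T⊆) = map⁺ (Any.map T⊆ins S⊆∈gs)
    where
    T⊆ins : ∀ {G} → S ⊆ G → T ⊆ insSimplex i G
    T⊆ins S⊆G = ⊆-trans T⊆ (insSimplex-mono i S⊆G)
  from′ : ⟨ map (insSimplex i) gs ⟩ T → ins i ⟨ gs ⟩ T
  from′ T⊆∈ with find (map⁻ T⊆∈)
  ... | G , G∈gs , T⊆ = G , Any.map (λ { refl x∈G → x∈G }) G∈gs , T⊆

image-∘-section : ∀ {k} (f : Fin m → Fin k) (g : Fin k → Fin m) → (∀ y → f (g y) ≡ y) →
  ∀ S → image f (image g S) ≡ S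
image-∘-section f g fg S = ⊆-antisym ⊆S S⊆
  where
  ⊆S : image f (image g S) ⊆ S
  ⊆S y∈ with ∈-image⁻ f {image g S} y∈
  ... | x , x∈ , refl with ∈-image⁻ g {S} x∈
  ...   | s , s∈S , refl = subst (_∈ S) (sym (fg s)) s∈S
  S⊆ : S ⊆ image f (image g S)
  S⊆ {s} s∈S = subst (_∈ image f (image g S)) (fg s) (∈-image⁺ f (∈-image⁺ g s∈S))

rot-⟨⟩ : ∀ {k} c (gs : List (Subset (suc k))) → rot c ⟨ gs ⟩ ≅ ⟨ map (image (shiftFin c)) gs ⟩
rot-⟨⟩ {k} c gs T = to′ , from′
  where
  f g : Fin (suc k) → Fin (suc k)
  f = shiftFin c
  g = shiftFin (c ℕ.* k)
  to′ : rot c ⟨ gs ⟩ T → ⟨ map (image f) gs ⟩ T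
  to′ (S , S⊆∈gs , refl) = map⁺ (Any.map (image-mono f) S⊆∈gs)
  from′ : ⟨ map (image f) gs ⟩ T → rot c ⟨ gs ⟩ T
  from′ T⊆∈ with find (map⁻ T⊆∈)
  ... | G , G∈gs , T⊆fG =
    image g T , Any.map (λ { refl y∈ → gT⊆G y∈ }) G∈gs , sym (image-∘-section f g (shiftFin-section c) T)
    where
    gT⊆G : image g T ⊆ G
    gT⊆G y∈ with ∈-image⁻ g {T} y∈
    ... | t , t∈T , refl with ∈-image⁻ f {G} (T⊆fG t∈T)
    ...   | x , x∈G , refl = subst (_∈ G) (sym (shiftFin-retraction c x)) x∈G

module _ {K : Complex m} where

  obtainable-ins : {gs : List (Subset n)} → Obtainable K ⟨ gs ⟩ → (i : Fin (suc n)) →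
    Obtainable K ⟨ map (insSimplex i) gs ⟩
  obtainable-ins {gs = gs} (L₀ , K↝L₀ , L₀≅) i =
    ins i L₀ , byIns K↝L₀ i , ≅-trans (ins-cong i L₀≅) (ins-⟨⟩ i gs)

  obtainable-rot : ∀ {k} {gs : List (Subset (suc k))} → Obtainable K ⟨ gs ⟩ → (c : ℕ) →
    Obtainable K ⟨ map (image (shiftFin c)) gs ⟩
  obtainable-rot {gs = gs} (L₀ , K↝L₀ , L₀≅) c =
    rot c L₀ , byRot K↝L₀ c , ≅-trans (rot-cong c L₀≅) (rot-⟨⟩ c gs)

-- Gaps and vertex insertion

Outside : ℕ → ℕ → ℕ → Set
Outside u v z = z < u ⊎ v ≤ z

-- The cyclic interval ⟦v, u - 1⟧ of I_n (for u ≤ v ≤ n) as the complement of the gap [u, v).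
avoid : ℕ → ℕ → Subset n
avoid u v = tabulate λ x → ⌊ toℕ x <? u ⊎-dec v ≤? toℕ x ⌋

∈-avoid : ∀ {u v} {x : Fin n} {z} → toℕ x ≡ z → x ∈ avoid u v ⇔ Outside u v z
∈-avoid refl = mk⇔ (toWitness ∘ to ∈-tabulate) (from ∈-tabulate ∘ fromWitness)

Outside-suc : ∀ {u v z} → Outside (suc u) (suc v) (suc z) ⇔ Outside u v z
Outside-suc = mk⇔ (Sum.map s≤s⁻¹ s≤s⁻¹) (Sum.map s≤s s≤s)

both : ∀ {A B : Set} → A → B → A ⇔ B
both a b = mk⇔ (λ _ → b) (λ _ → a)

neither : ∀ {A B : Set} → ¬ A → ¬ B → A ⇔ B
neither ¬a ¬b = mk⇔ (⊥-elim ∘ ¬a) (⊥-elim ∘ ¬b)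

¬Outside : ∀ {u v z} → u ≤ z → z < v → ¬ Outside u v z
¬Outside u≤z z<v (inj₁ z<u) = ℕ.<⇒≱ z<u u≤z
¬Outside u≤z z<v (inj₂ v≤z) = ℕ.<⇒≱ z<v v≤z

toℕ-punchIn-< : (i : Fin (suc n)) (x : Fin n) → toℕ x < toℕ i → toℕ (punchIn i x) ≡ toℕ x
toℕ-punchIn-< (Fin.suc i) Fin.zero    _         = refl
toℕ-punchIn-< (Fin.suc i) (Fin.suc x) (s≤s x<i) = cong suc (toℕ-punchIn-< i x x<i)

toℕ-punchIn-≥ : (i : Fin (suc n)) (x : Fin n) → toℕ i ≤ toℕ x → toℕ (punchIn i x) ≡ suc (toℕ x)
toℕ-punchIn-≥ Fin.zero    x           _         = refl
toℕ-punchIn-≥ (Fin.suc i) (Fin.suc x) (s≤s i≤x) = cong suc (toℕ-punchIn-≥ i x i≤x)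

modN-pred : ∀ {n l} → suc l < n → modN n (suc l ℕ.+ (n ℕ.∸ 1)) ≡ l
modN-pred {suc k} {l} (s≤s l<k) =
  trans (cong (_% suc k) (sym (ℕ.+-suc l k)))
        (trans ([m+n]%n≡m%n l (suc k)) (m<n⇒m%n≡m (ℕ.m<n⇒m<1+n l<k)))

modN-< : ∀ {n l} → l < n → modN n l ≡ l
modN-< {suc k} l<n = m<n⇒m%n≡m l<n

-- Insertion of a vertex between the old vertices l and l + 1, away from the wrap-around at 0.
module Insertion {n l : ℕ} (l+1<n : suc l < n) where

  i : Fin (suc n)
  i = fromℕ< (ℕ.m<n⇒m<1+n l+1<n)

  toℕ-i : toℕ i ≡ suc l
  toℕ-i = Fin.toℕ-fromℕ< (ℕ.m<n⇒m<1+n l+1<n)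

  Near-i : ∀ {j} → Near i j ⇔ (toℕ j ≡ l ⊎ toℕ j ≡ suc l)
  Near-i = mk⇔ (Sum.map (λ e → trans e before) (λ e → trans e at))
               (Sum.map (λ e → trans e (sym before)) (λ e → trans e (sym at)))
    where
    before : modN n (toℕ i ℕ.+ (n ℕ.∸ 1)) ≡ l
    before = trans (cong (λ t → modN n (t ℕ.+ (n ℕ.∸ 1))) toℕ-i) (modN-pred l+1<n)
    at : modN n (toℕ i) ≡ suc l
    at = trans (cong (modN n) toℕ-i) (modN-< l+1<n)

  adjacent-avoid : ∀ {u v} → T (adjacent i (avoid u v)) ⇔ (Outside u v l ⊎ Outside u v (suc l))
  adjacent-avoid {u} {v} = mk⇔ to′ from′ ⇔-∘ adjacent⇔ i (avoid u v)
    where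
    l<n = ℕ.<-trans (n<1+n l) l+1<n
    to′ : ∃[ j ] (j ∈ avoid u v × Near i j) → Outside u v l ⊎ Outside u v (suc l)
    to′ (j , j∈ , near) = Sum.map (λ j≡ → to (∈-avoid j≡) j∈) (λ j≡ → to (∈-avoid j≡) j∈) (to Near-i near)
    from′ : Outside u v l ⊎ Outside u v (suc l) → ∃[ j ] (j ∈ avoid u v × Near i j)
    from′ (inj₁ out) = fromℕ< l<n , from (∈-avoid (Fin.toℕ-fromℕ< l<n)) out ,
      from Near-i (inj₁ (Fin.toℕ-fromℕ< l<n))
    from′ (inj₂ out) = fromℕ< l+1<n , from (∈-avoid (Fin.toℕ-fromℕ< l+1<n)) out ,
      from Near-i (inj₂ (Fin.toℕ-fromℕ< l+1<n))

  toℕ-punchIn-≤ : ∀ {x} → toℕ x ≤ l → toℕ (punchIn i x) ≡ toℕ x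
  toℕ-punchIn-≤ {x} x≤l = toℕ-punchIn-< i x (subst (toℕ x <_) (sym toℕ-i) (s≤s x≤l))

  toℕ-punchIn-> : ∀ {x} → l < toℕ x → toℕ (punchIn i x) ≡ suc (toℕ x)
  toℕ-punchIn-> {x} l<x = toℕ-punchIn-≥ i x (subst (_≤ toℕ x) (sym toℕ-i) l<x)

  -- The new vertex enters iff l or l + 1 is in the facet; the old vertices above l move up by one.
  insSimplex-avoid : ∀ {u v u′ v′} →
    Outside u′ v′ (suc l) ⇔ (Outside u v l ⊎ Outside u v (suc l)) →
    (∀ {z} → z ≤ l → Outside u′ v′ z ⇔ Outside u v z) →
    (∀ {z} → l < z → Outside u′ v′ (suc z) ⇔ Outside u v z) →
    insSimplex i (avoid u v) ≡ avoid u′ v′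
  insSimplex-avoid {u} {v} {u′} {v′} at-i below above =
    insSimplex-unique i (avoid u v) (⇔-sym adjacent-avoid ⇔-∘ (at-i ⇔-∘ ∈-avoid toℕ-i)) at-punchIn
    where
    at-punchIn : ∀ x → punchIn i x ∈ avoid u′ v′ ⇔ x ∈ avoid u v
    at-punchIn x with toℕ x ℕ.≤? l
    ... | yes x≤l = ⇔-sym (∈-avoid refl) ⇔-∘ (below x≤l ⇔-∘ ∈-avoid (toℕ-punchIn-≤ x≤l))
    ... | no  x≰l = ⇔-sym (∈-avoid refl) ⇔-∘ (above (ℕ.≰⇒> x≰l) ⇔-∘ ∈-avoid (toℕ-punchIn-> (ℕ.≰⇒> x≰l)))

  insSimplex-avoid-before : ∀ {u v} → v ≤ l → insSimplex i (avoid u v) ≡ avoid u v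
  insSimplex-avoid-before v≤l = insSimplex-avoid
    (both (inj₂ (ℕ.m≤n⇒m≤1+n v≤l)) (inj₁ (inj₂ v≤l)))
    (λ _ → ⇔-id _)
    (λ l<z → both (inj₂ (ℕ.m≤n⇒m≤1+n (≤-trans v≤l (ℕ.<⇒≤ l<z)))) (inj₂ (≤-trans v≤l (ℕ.<⇒≤ l<z))))

  insSimplex-avoid-around : ∀ {u v} → u ≤ l → suc l < v → insSimplex i (avoid u v) ≡ avoid u (suc v)
  insSimplex-avoid-around u≤l l+1<v = insSimplex-avoid
    (neither (¬Outside (ℕ.m≤n⇒m≤1+n u≤l) (s≤s (ℕ.<⇒≤ l+1<v)))
             (Sum.[_,_] (¬Outside u≤l l<v) (¬Outside (ℕ.m≤n⇒m≤1+n u≤l) l+1<v)))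
    (λ z≤l → let z<v = ℕ.≤-<-trans z≤l l<v in
      ⇔-id _ ⊎-⇔ neither (ℕ.<⇒≱ (ℕ.m<n⇒m<1+n z<v)) (ℕ.<⇒≱ z<v))
    (λ l<z → let u<z = ℕ.≤-<-trans u≤l l<z in
      neither (ℕ.<⇒≱ (ℕ.m<n⇒m<1+n (ℕ.m<n⇒m<1+n u<z))) (ℕ.<⇒≱ (ℕ.m<n⇒m<1+n u<z)) ⊎-⇔ mk⇔ s≤s⁻¹ s≤s)
    where
    l<v = ℕ.<-trans (n<1+n l) l+1<v

  insSimplex-avoid-after : ∀ {u v} → suc l < u → insSimplex i (avoid u v) ≡ avoid (suc u) (suc v)
  insSimplex-avoid-after l+1<u = insSimplex-avoid
    (both (inj₁ (s≤s (ℕ.<⇒≤ l+1<u))) (inj₂ (inj₁ l+1<u)))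
    (λ z≤l → let z<u = ℕ.≤-<-trans z≤l (ℕ.<-trans (n<1+n l) l+1<u) in
      both (inj₁ (ℕ.m<n⇒m<1+n z<u)) (inj₁ z<u))
    (λ _ → Outside-suc)

-- Growing the gaps of K₈

Facets : (n p₁ p₂ p₃ : ℕ) → List (Subset n)
Facets n p₁ p₂ p₃ = avoid p₂ p₃ ∷ avoid p₁ p₂ ∷ avoid 0 p₁ ∷ avoid p₃ n ∷ []

Reachable : (n p₁ p₂ p₃ : ℕ) → Set₁
Reachable n p₁ p₂ p₃ = Obtainable K₈ ⟨ Facets n p₁ p₂ p₃ ⟩

record Shape (n p₁ p₂ p₃ : ℕ) : Set where
  constructor shape
  field
    1<p₁    : 1 < p₁
    p₁+1<p₂ : suc p₁ < p₂
    p₂+1<p₃ : suc p₂ < p₃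
    p₃+1<n  : suc p₃ < n

  p₁<p₂ : p₁ < p₂
  p₁<p₂ = <-trans (n<1+n p₁) p₁+1<p₂

  p₂<p₃ : p₂ < p₃
  p₂<p₃ = <-trans (n<1+n p₂) p₂+1<p₃

  p₃<n : p₃ < n
  p₃<n = <-trans (n<1+n p₃) p₃+1<n

  p₁<p₃ : p₁ < p₃
  p₁<p₃ = <-trans p₁<p₂ p₂<p₃

reachable-K₈ : Reachable 8 2 4 6
reachable-K₈ = K₈ , done , ⟨⟩-reverse _

widen : ∀ {n p₁ p₂ p₃ q₁ q₂ q₃} → Reachable n p₁ p₂ p₃ → (i : Fin (suc n)) →
  insSimplex i (avoid p₂ p₃) ≡ avoid q₂ q₃ → insSimplex i (avoid p₁ p₂) ≡ avoid q₁ q₂ →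
  insSimplex i (avoid 0 p₁) ≡ avoid 0 q₁ → insSimplex i (avoid p₃ n) ≡ avoid q₃ (suc n) →
  Reachable (suc n) q₁ q₂ q₃
widen R i e₁ e₂ e₃ e₄ = subst (Obtainable K₈ ∘ ⟨_⟩)
  (cong₂ _∷_ e₁ (cong₂ _∷_ e₂ (cong₂ _∷_ e₃ (cong (_∷ []) e₄)))) (obtainable-ins R i)

-- widenⱼ inserts a vertex right after the j-th of the cut points 0, p₁, p₂, p₃,
-- lengthening the gap that starts there.
module _ {n p₁ p₂ p₃} (sh : Shape n p₁ p₂ p₃) (R : Reachable n p₁ p₂ p₃) where
  open Shape sh

  widen₀ : Reachable (suc n) (suc p₁) (suc p₂) (suc p₃)
  widen₀ = widen R i
    (insSimplex-avoid-after (<-trans 1<p₁ p₁<p₂))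
    (insSimplex-avoid-after 1<p₁)
    (insSimplex-avoid-around z≤n 1<p₁)
    (insSimplex-avoid-after (<-trans 1<p₁ p₁<p₃))
    where open Insertion (<-trans 1<p₁ (<-trans p₁<p₃ p₃<n))

  widen₁ : Reachable (suc n) p₁ (suc p₂) (suc p₃)
  widen₁ = widen R i
    (insSimplex-avoid-after p₁+1<p₂)
    (insSimplex-avoid-around ≤-refl p₁+1<p₂)
    (insSimplex-avoid-before ≤-refl)
    (insSimplex-avoid-after (<-trans p₁+1<p₂ p₂<p₃))
    where open Insertion (<-trans p₁+1<p₂ (<-trans p₂<p₃ p₃<n))

  widen₂ : Reachable (suc n) p₁ p₂ (suc p₃)
  widen₂ = widen R i
    (insSimplex-avoid-around ≤-refl p₂+1<p₃)
    (insSimplex-avoid-before ≤-refl)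
    (insSimplex-avoid-before (ℕ.<⇒≤ p₁<p₂))
    (insSimplex-avoid-after p₂+1<p₃)
    where open Insertion (<-trans p₂+1<p₃ p₃<n)

  widen₃ : Reachable (suc n) p₁ p₂ p₃
  widen₃ = widen R i
    (insSimplex-avoid-before ≤-refl)
    (insSimplex-avoid-before (ℕ.<⇒≤ p₂<p₃))
    (insSimplex-avoid-before (ℕ.<⇒≤ p₁<p₃))
    (insSimplex-avoid-around ≤-refl p₃+1<n)
    where open Insertion p₃+1<n

≤-induction : ∀ {ℓ} (P : ℕ → Set ℓ) {m} → P m → (∀ {x} → m ≤ x → P x → P (suc x)) → ∀ {n} → m ≤ n → P n
≤-induction P {m} Pm step m≤n = go (ℕ.≤⇒≤′ m≤n)
  where
  go : ∀ {n} → m ℕ.≤′ n → P n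
  go ℕ.≤′-refl = Pm
  go (ℕ.≤′-step m≤′n) = step (ℕ.≤′⇒≤ m≤′n) (go m≤′n)

-- Grow the gaps of K₈ one at a time, from [0, p₁) to [p₃, n).
reachable : ∀ {n p₁ p₂ p₃} → Shape n p₁ p₂ p₃ → Reachable n p₁ p₂ p₃
reachable {n} {p₁} {p₂} {p₃} (shape 1<p₁ p₁+1<p₂ p₂+1<p₃ p₃+1<n) =
  ≤-induction (λ x → Reachable x p₁ p₂ p₃)
    (≤-induction (λ x → Reachable (2 ℕ.+ x) p₁ p₂ x)
      (≤-induction (λ x → Reachable (4 ℕ.+ x) p₁ x (2 ℕ.+ x))
        (≤-induction (λ x → Reachable (6 ℕ.+ x) x (2 ℕ.+ x) (4 ℕ.+ x))
          reachable-K₈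
          (λ 1<x → widen₀ (shape 1<x ≤-refl ≤-refl ≤-refl)) 1<p₁)
        (λ p₁+1<x → widen₁ (shape 1<p₁ p₁+1<x ≤-refl ≤-refl)) p₁+1<p₂)
      (λ p₂+1<x → widen₂ (shape 1<p₁ p₁+1<p₂ p₂+1<x ≤-refl)) p₂+1<p₃)
    (λ p₃+1<x → widen₃ (shape 1<p₁ p₁+1<p₂ p₂+1<p₃ p₃+1<x)) p₃+1<n

-- Rotating the gaps into place

a+b≡c+d⇒b≤d⇔c≤a : ∀ {a b c d} → a ℕ.+ b ≡ c ℕ.+ d → b ≤ d ⇔ c ≤ a
a+b≡c+d⇒b≤d⇔c≤a {a} {b} {c} {d} eq = mk⇔
  (λ b≤d → ℕ.+-cancelʳ-≤ d c a (subst (_≤ a ℕ.+ d) eq (ℕ.+-monoʳ-≤ a b≤d)))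
  (λ c≤a → ℕ.+-cancelˡ-≤ a b d (subst (_≤ a ℕ.+ d) (sym eq) (ℕ.+-monoˡ-≤ d c≤a)))

module _ {k : ℕ} where

  ∈-⟦⟧ : ∀ {A B} {y : Fin (suc k)} → y ∈ ⟦ A , B ⟧ ⇔ (+ toℕ y - A) %ℕ suc k ≤ (B - A) %ℕ suc k
  ∈-⟦⟧ {A} {B} {y} =
    mk⇔ to′ from′ ⇔-∘ ∈-tabulate {f = λ x → any (λ t → ((A + + t) modI suc k) x) (upTo (suc L))}
    where
    L = (B - A) %ℕ suc k
    hit? : ℕ → Bool
    hit? t = ⌊ (A + + t) %ℕ suc k ℕ.≟ toℕ y ⌋
    to′ : T (any hit? (upTo (suc L))) → (+ toℕ y - A) %ℕ suc k ≤ L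
    to′ t∈ with find (any⁻ hit? (upTo (suc L)) t∈)
    ... | t , t∈upTo , hit with ∈-upTo⁻ t∈upTo
    ...   | t<L+1 = subst (_≤ L) (sym (%ℕ-≡ (ℕ.<-≤-trans t<L+1 (n%ℕd<d (B - A) (suc k))) (begin
      + toℕ y - A                   ≡⟨ cong (λ r → + r - A) (toWitness hit) ⟨
      + ((A + + t) %ℕ suc k) - A    ≈⟨ ≡mod-- (≡mod-sym (≡mod-%ℕ (A + + t))) ≡mod-refl ⟩
      A + + t - A                   ≡⟨ lemma A (+ t) ⟩
      + t                           ∎))) (ℕ.≤-pred t<L+1)
      where
      open ≡mod-Reasoning
      lemma : ∀ a b → a + b - a ≡ b
      lemma = solve-∀
    from′ : (+ toℕ y - A) %ℕ suc k ≤ L → T (any hit? (upTo (suc L)))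
    from′ r≤L = any⁺ hit? (lose (∈-upTo⁺ (s≤s r≤L)) (fromWitness (%ℕ-≡ (Fin.toℕ<n y) (begin
      A + + r                      ≈⟨ ≡mod-+ (≡mod-refl {a = A}) (≡mod-sym (≡mod-%ℕ (+ toℕ y - A))) ⟩
      A + (+ toℕ y - A)            ≡⟨ lemma A (+ toℕ y) ⟩
      + toℕ y                      ∎))))
      where
      open ≡mod-Reasoning
      r = (+ toℕ y - A) %ℕ suc k
      lemma : ∀ a b → a + (b - a) ≡ b
      lemma = solve-∀

  %ℕ-gap-past : ∀ {u v d e z} {a : ℤ} → u ℕ.+ d ≡ v → d ℕ.+ e ≡ k → z < suc k →
    a ≡ + z - + v [mod suc k ] → v ≤ z → a %ℕ suc k ≤ e
  %ℕ-gap-past {u} {v} {d} {e} {z} {a} ud de z<n a≡ v≤z =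
    subst (_≤ e) (sym a%≡w) (ℕ.+-cancelˡ-≤ d w e (begin
      d ℕ.+ w           ≤⟨ ℕ.+-monoˡ-≤ w (ℕ.m≤n+m d u) ⟩
      u ℕ.+ d ℕ.+ w     ≡⟨ cong (ℕ._+ w) ud ⟩
      v ℕ.+ w           ≡⟨ vw ⟩
      z                 ≤⟨ ℕ.≤-pred z<n ⟩
      k                 ≡⟨ de ⟨
      d ℕ.+ e           ∎))
    where
    open ℕ.≤-Reasoning
    w = z ℕ.∸ v
    vw : v ℕ.+ w ≡ z
    vw = ℕ.m+[n∸m]≡n v≤z
    a%≡w : a %ℕ suc k ≡ w
    a%≡w = %ℕ-≡ (ℕ.≤-<-trans (ℕ.m∸n≤m z v) z<n)
      (≡mod-trans a≡ (≡⇒≡mod (trans (cong (λ t → + t - + v) (sym vw)) (lemma (+ v) (+ w)))))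
      where
      lemma : ∀ a b → a + b - a ≡ b
      lemma = solve-∀

  %ℕ-gap-before : ∀ {u v d e z} {a : ℤ} → u ℕ.+ d ≡ v → d ℕ.+ e ≡ k → v ≤ suc k →
    a ≡ + z - + v [mod suc k ] → z < v → a %ℕ suc k ≤ e ⇔ z < u
  %ℕ-gap-before {u} {v} {d} {e} {z} {a} ud de v≤n a≡ z<v =
    subst (λ r → r ≤ e ⇔ z < u) (sym a%≡w) (a+b≡c+d⇒b≤d⇔c≤a uw≡)
    where
    s = v ℕ.∸ z
    zs : z ℕ.+ s ≡ v
    zs = ℕ.m+[n∸m]≡n (ℕ.<⇒≤ z<v)
    w = suc k ℕ.∸ s
    sw : s ℕ.+ w ≡ suc k
    sw = ℕ.m+[n∸m]≡n (≤-trans (ℕ.m∸n≤m v z) v≤n)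
    a%≡w : a %ℕ suc k ≡ w
    a%≡w = %ℕ-≡ (subst (w <_) sw (ℕ.m<n+m w (ℕ.m<n⇒0<n∸m z<v))) (begin
      a                                   ≈⟨ a≡ ⟩
      + z - + v                           ≡⟨ cong (λ t → + z - + t) zs ⟨
      + z - (+ z + + s)                   ≡⟨ lemma (+ z) (+ s) (+ w) ⟩
      + w + (- + 1) * (+ s + + w)         ≡⟨ cong (λ t → + w + (- + 1) * + t) sw ⟩
      + w + (- + 1) * + suc k             ≈⟨ - + 1 , refl ⟩
      + w                                 ∎)
      where
      open ≡mod-Reasoning
      lemma : ∀ z s w → z - (z + s) ≡ w + (- + 1) * (s + w)
      lemma = solve-∀
    uw≡ : u ℕ.+ w ≡ suc z ℕ.+ e
    uw≡ = ℕ.+-cancelʳ-≡ s (u ℕ.+ w) (suc z ℕ.+ e) (begin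
      u ℕ.+ w ℕ.+ s              ≡⟨ lemma₁ u w s ⟩
      u ℕ.+ (s ℕ.+ w)            ≡⟨ cong (u ℕ.+_) (trans sw (cong suc (sym de))) ⟩
      u ℕ.+ suc (d ℕ.+ e)        ≡⟨ lemma₂ u d e ⟩
      suc (u ℕ.+ d ℕ.+ e)        ≡⟨ cong (λ t → suc (t ℕ.+ e)) (trans ud (sym zs)) ⟩
      suc (z ℕ.+ s ℕ.+ e)        ≡⟨ lemma₃ z s e ⟩
      suc z ℕ.+ e ℕ.+ s          ∎)
      where
      open ≡-Reasoning
      lemma₁ : ∀ u w s → u ℕ.+ w ℕ.+ s ≡ u ℕ.+ (s ℕ.+ w)
      lemma₁ = ℕ-Solver.solve-∀
      lemma₂ : ∀ u d e → u ℕ.+ suc (d ℕ.+ e) ≡ suc (u ℕ.+ d ℕ.+ e)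
      lemma₂ = ℕ-Solver.solve-∀
      lemma₃ : ∀ z s e → suc (z ℕ.+ s ℕ.+ e) ≡ suc z ℕ.+ e ℕ.+ s
      lemma₃ = ℕ-Solver.solve-∀

  -- The remainder of z - v is z - v when v ≤ z and n - (v - z) otherwise; e = n - 1 - (v - u).
  %ℕ-gap : ∀ {u v d e z} {a : ℤ} → u ℕ.+ d ≡ v → d ℕ.+ e ≡ k → v ≤ suc k → z < suc k →
    a ≡ + z - + v [mod suc k ] → a %ℕ suc k ≤ e ⇔ Outside u v z
  %ℕ-gap ud de v≤n z<n a≡ with _ ℕ.≤? _
  ... | yes v≤z = both (%ℕ-gap-past ud de z<n a≡ v≤z) (inj₂ v≤z)
  ... | no v≰z =
    mk⇔ inj₁ (Sum.[_,_] (λ z<u → z<u) (⊥-elim ∘ v≰z)) ⇔-∘ %ℕ-gap-before ud de v≤n a≡ (ℕ.≰⇒> v≰z)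

  ≡mod-shiftFin-offset : ∀ a₀ {v A} (x : Fin (suc k)) → A ≡ a₀ + + v [mod suc k ] →
    + toℕ (shiftFin (a₀ %ℕ suc k) x) - A ≡ + toℕ x - + v [mod suc k ]
  ≡mod-shiftFin-offset a₀ {v} {A} x A≡ = begin
    + toℕ (shiftFin c x) - A          ≈⟨ ≡mod-- (shiftFin-≡mod c x) A≡ ⟩
    + toℕ x + + c - (a₀ + + v)        ≈⟨ ≡mod-- (≡mod-+ (≡mod-refl {a = + toℕ x}) c≡a₀) ≡mod-refl ⟩
    + toℕ x + a₀ - (a₀ + + v)         ≡⟨ lemma (+ toℕ x) a₀ (+ v) ⟩
    + toℕ x - + v                     ∎
    where
    open ≡mod-Reasoning
    c = a₀ %ℕ suc k
    c≡a₀ : + c ≡ a₀ [mod suc k ]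
    c≡a₀ = ≡mod-sym (≡mod-%ℕ a₀)
    lemma : ∀ x a v → x + a - (a + v) ≡ x - v
    lemma = solve-∀

  %ℕ-arc-length : ∀ {a₀ u v d e A B} → u ℕ.+ d ≡ v → d ℕ.+ e ≡ k →
    A ≡ a₀ + + v [mod suc k ] → B ≡ a₀ + + u - + 1 [mod suc k ] → (B - A) %ℕ suc k ≡ e
  %ℕ-arc-length {a₀} {u} {v} {d} {e} {A} {B} ud de A≡ B≡ =
    %ℕ-≡ (s≤s (subst (e ≤_) de (ℕ.m≤n+m e d))) (begin
      B - A                                  ≈⟨ ≡mod-- B≡ A≡ ⟩
      a₀ + + u - + 1 - (a₀ + + v)            ≡⟨ cong (λ t → a₀ + + u - + 1 - (a₀ + + t)) ud ⟨
      a₀ + + u - + 1 - (a₀ + (+ u + + d))    ≡⟨ lemma a₀ (+ u) (+ d) (+ e) ⟩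
      + e + (- + 1) * (+ 1 + (+ d + + e))    ≡⟨ cong (λ t → + e + (- + 1) * + suc t) de ⟩
      + e + (- + 1) * + suc k                ≈⟨ - + 1 , refl ⟩
      + e                                    ∎)
    where
    open ≡mod-Reasoning
    lemma : ∀ a u d e → a + u - + 1 - (a + (u + d)) ≡ e + (- + 1) * (+ 1 + (d + e))
    lemma = solve-∀

  image-shiftFin-avoid : ∀ a₀ {u v} {A B : ℤ} → u ≤ v → v ≤ suc k → v ≤ u ℕ.+ k →
    A ≡ a₀ + + v [mod suc k ] → B ≡ a₀ + + u - + 1 [mod suc k ] →
    image (shiftFin (a₀ %ℕ suc k)) (avoid u v) ≡ ⟦ A , B ⟧
  image-shiftFin-avoid a₀ {u} {v} {A} {B} u≤v v≤n v≤u+k A≡ B≡ =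
    image-surjective (shiftFin c) (shiftFin (c ℕ.* k)) (shiftFin-section c) λ x →
      ⇔-sym (∈-avoid refl) ⇔-∘ (%ℕ-gap ud de v≤n (Fin.toℕ<n x) (≡mod-shiftFin-offset a₀ x A≡) ⇔-∘
        subst (λ L → shiftFin c x ∈ ⟦ A , B ⟧ ⇔ (+ toℕ (shiftFin c x) - A) %ℕ suc k ≤ L)
              (%ℕ-arc-length {a₀} ud de A≡ B≡) (∈-⟦⟧ {A} {B}))
    where
    c = a₀ %ℕ suc k
    d = v ℕ.∸ u
    ud : u ℕ.+ d ≡ v
    ud = ℕ.m+[n∸m]≡n u≤v
    d≤k : d ≤ k
    d≤k = ℕ.+-cancelˡ-≤ u d k (subst (_≤ u ℕ.+ k) (sym ud) v≤u+k)
    de : d ℕ.+ (k ℕ.∸ d) ≡ k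
    de = ℕ.m+[n∸m]≡n d≤k

Arcs : ∀ {n} → ℤ → ℤ → ℤ → ℤ → List (Subset n)
Arcs a₀ a₁ a₂ a₃ = ⟦ a₃ , a₂ - + 1 ⟧ ∷ ⟦ a₂ , a₁ - + 1 ⟧ ∷ ⟦ a₁ , a₀ - + 1 ⟧ ∷ ⟦ a₀ , a₃ - + 1 ⟧ ∷ []

obtainable-Arcs : ∀ {k p₁ p₂ p₃} → Shape (suc k) p₁ p₂ p₃ → ∀ {a₀ a₁ a₂ a₃} →
  a₁ ≡ a₀ + + p₁ → a₂ ≡ a₀ + + p₂ → a₃ ≡ a₀ + + p₃ → Obtainable K₈ ⟨ Arcs {suc k} a₀ a₁ a₂ a₃ ⟩
obtainable-Arcs {k} {p₁} {p₂} {p₃} sh {a₀} {a₁} {a₂} {a₃} a₁≡ a₂≡ a₃≡ =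
  subst (Obtainable K₈ ∘ ⟨_⟩) (cong₂ _∷_ arc₁ (cong₂ _∷_ arc₂ (cong₂ _∷_ arc₃ (cong (_∷ []) arc₄))))
    (obtainable-rot (reachable sh) (a₀ %ℕ suc k))
  where
  open Shape sh
  f = image (shiftFin (a₀ %ℕ suc k))
  p₃≤k : p₃ ≤ k
  p₃≤k = ℕ.≤-pred p₃<n
  p₁≤k : p₁ ≤ k
  p₁≤k = ≤-trans (ℕ.<⇒≤ p₁<p₃) p₃≤k
  -1≡ : ∀ {a b} → a ≡ b → a - + 1 ≡ b - + 1 [mod suc k ]
  -1≡ = ≡⇒≡mod ∘ cong (_- + 1)
  arc₁ : f (avoid p₂ p₃) ≡ ⟦ a₃ , a₂ - + 1 ⟧
  arc₁ = image-shiftFin-avoid a₀ (ℕ.<⇒≤ p₂<p₃) (ℕ.<⇒≤ p₃<n) (≤-trans p₃≤k (ℕ.m≤n+m k p₂))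
    (≡⇒≡mod a₃≡) (-1≡ a₂≡)
  arc₂ : f (avoid p₁ p₂) ≡ ⟦ a₂ , a₁ - + 1 ⟧
  arc₂ = image-shiftFin-avoid a₀ (ℕ.<⇒≤ p₁<p₂) (ℕ.<⇒≤ (<-trans p₂<p₃ p₃<n))
    (≤-trans (ℕ.<⇒≤ p₂<p₃) (≤-trans p₃≤k (ℕ.m≤n+m k p₁))) (≡⇒≡mod a₂≡) (-1≡ a₁≡)
  arc₃ : f (avoid 0 p₁) ≡ ⟦ a₁ , a₀ - + 1 ⟧
  arc₃ = image-shiftFin-avoid a₀ z≤n (ℕ.m≤n⇒m≤1+n p₁≤k) p₁≤k (≡⇒≡mod a₁≡) (-1≡ (sym (+-identityʳ a₀)))
  arc₄ : f (avoid p₃ (suc k)) ≡ ⟦ a₀ , a₃ - + 1 ⟧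
  arc₄ = image-shiftFin-avoid a₀ (ℕ.<⇒≤ p₃<n) ≤-refl (ℕ.+-monoˡ-≤ k (ℕ.<⇒≤ (<-trans 1<p₁ p₁<p₃)))
    (- + 1 , lemma a₀ (+ suc k)) (-1≡ a₃≡)
    where
    lemma : ∀ a n → a ≡ a + n + (- + 1) * n
    lemma = solve-∀

≤-difference : ∀ {m} a b → + m ≤ℤ b - a → ∃[ d ] (b ≡ a + + d × m ≤ d)
≤-difference a b m≤b-a with b - a in b-a≡ | m≤b-a
... | + d | ℤ.+≤+ m≤d = d , trans (lemma a b) (cong (λ x → a + x) b-a≡) , m≤d
  where
  lemma : ∀ a b → b ≡ a + (b - a)
  lemma = solve-∀

+-offset-trans : ∀ {a b c d d′} → b ≡ a + + d → c ≡ b + + d′ → c ≡ a + + (d′ ℕ.+ d)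
+-offset-trans {a} {d = d} {d′} refl refl = lemma a (+ d) (+ d′)
  where
  lemma : ∀ a d d′ → a + d + d′ ≡ a + (d′ + d)
  lemma = solve-∀

b≡a+d⇒b-a≡d : ∀ {a b d} → b ≡ a + + d → b - a ≡ + d
b≡a+d⇒b-a≡d {a} {d = d} refl = lemma a (+ d)
  where
  lemma : ∀ a d → a + d - a ≡ d
  lemma = solve-∀

m≤n-o⇒o+m≤n : ∀ {m n o} → + m ≤ℤ + n - + o → o ℕ.+ m ≤ n
m≤n-o⇒o+m≤n {m} {n} {o} m≤n-o = subst (_≤ n) (ℕ.+-comm m o)
  (ℤ.drop‿+≤+ (subst (+ (m ℕ.+ o) ≤ℤ_) (lemma (+ n) (+ o)) (ℤ.+-monoˡ-≤ (+ o) m≤n-o)))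
  where
  lemma : ∀ n o → n - o + o ≡ n
  lemma = solve-∀

proposition6p12 : (n : ℕ) → 8 ≤ n → (a₀ a₁ a₂ a₃ : ℤ)
    → + 2 ≤ℤ a₁ - a₀ → + 2 ≤ℤ a₂ - a₁ → + 2 ≤ℤ a₃ - a₂
    → a₃ - a₀ ≤ℤ + n - + 2
    → Obtainable {n = n} K₈
    ⟨ ⟦ a₃ , a₂ - + 1 ⟧ ∷ ⟦ a₂ , a₁ - + 1 ⟧ ∷ ⟦ a₁ , a₀ - + 1 ⟧ ∷ ⟦ a₀ , a₃ - + 1 ⟧ ∷ [] ⟩
proposition6p12 (suc k) _ a₀ a₁ a₂ a₃ 2≤a₁-a₀ 2≤a₂-a₁ 2≤a₃-a₂ a₃-a₀≤n-2
  with d₁ , a₁≡ , 2≤d₁ ← ≤-difference a₀ a₁ 2≤a₁-a₀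
  with d₂ , a₂≡ , 2≤d₂ ← ≤-difference a₁ a₂ 2≤a₂-a₁
  with d₃ , a₃≡ , 2≤d₃ ← ≤-difference a₂ a₃ 2≤a₃-a₂ =
  obtainable-Arcs
    (shape 2≤d₁ (ℕ.+-monoˡ-≤ d₁ 2≤d₂) (ℕ.+-monoˡ-≤ (d₂ ℕ.+ d₁) 2≤d₃)
      (m≤n-o⇒o+m≤n {o = 2} (subst (_≤ℤ + suc k - + 2) (b≡a+d⇒b-a≡d a₃≡a₀+p₃) a₃-a₀≤n-2)))
    a₁≡ a₂≡a₀+p₂ a₃≡a₀+p₃
  where
  a₂≡a₀+p₂ : a₂ ≡ a₀ + + (d₂ ℕ.+ d₁)
  a₂≡a₀+p₂ = +-offset-trans {a₀} {d = d₁} a₁≡ a₂≡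
  a₃≡a₀+p₃ : a₃ ≡ a₀ + + (d₃ ℕ.+ (d₂ ℕ.+ d₁))
  a₃≡a₀+p₃ = +-offset-trans {a₀} {d = d₂ ℕ.+ d₁} a₂≡a₀+p₂ a₃≡
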